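{- Let $1 \leq a < b$ be integers with $b \geq (2^{3/2}-1)a + 2 - 2^{3/2}$, and let $c=\lceil b/a \rceil$. Then $(a,b)$ is not regular and $dor(a,b) \leq \lceil \log_{\sqrt{2}} c \rceil$.
   Context: $\mathbf{N}=\{1,2,3,\dots\}$ and $[1,n]=\{1,2,\dots,n\}$. For integers $1 \leq a \leq b$, an $(a,b)$-triple is a set of the form $\{x,ax+d,bx+2d\}$ with $x,d \in \mathbf{N}$. $N(a,b;r)$ is the least positive integer, if it exists, such that every $r$-coloring of $[1,N(a,b;r)]$ contains a monochromatic $(a,b)$-triple. The pair $(a,b)$ is regular if $N(a,b;r)$ exists for all positive integers $r$; if not regular, its degree of regularity $dor(a,b)$ is the largest $r$ such that $N(a,b;r)$ exists. -}

module Defs where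

open import Data.Nat using (ℕ; zero; suc; _+_; _*_; _≤_; _/_)
open import Data.Nat.Logarithm using (⌈log₂_⌉)
open import Data.Fin using (Fin)
open import Data.Product using (Σ; ∃; _×_)
open import Relation.Binary.PropositionalEquality using (_≡_)

-- ⌈ m / n ⌉ for n ≥ 1 (value at n = 0 is irrelevant and set to 0).
ceilDiv : ℕ → ℕ → ℕ
ceilDiv m zero    = 0
ceilDiv m (suc n) = (m + n) / suc n

-- ⌈ log_{√2} c ⌉ = ⌈ log₂ (c²) ⌉  (least k with (√2)^k ≥ c, i.e. 2^k ≥ c²), for c ≥ 1.
ceilLogSqrt2 : ℕ → ℕ
ceilLogSqrt2 c = ⌈log₂ (c * c) ⌉

HasMonoTriple : ℕ → ℕ → (r n : ℕ) → (ℕ → Fin r) → Set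
HasMonoTriple a b r n χ =
  Σ ℕ λ x → Σ ℕ λ d →
    (1 ≤ x) × (1 ≤ d) ×
    (x ≤ n) × (a * x + d ≤ n) × (b * x + 2 * d ≤ n) ×
    (χ x ≡ χ (a * x + d)) × (χ x ≡ χ (b * x + 2 * d))

Forces : ℕ → ℕ → (r n : ℕ) → Set
Forces a b r n = (1 ≤ n) × ((χ : ℕ → Fin r) → HasMonoTriple a b r n χ)

NExists : ℕ → ℕ → ℕ → Set
NExists a b r = Σ ℕ λ n → Forces a b r n

Regular : ℕ → ℕ → Set
Regular a b = (r : ℕ) → NExists a b r

-- Colour y by ⌊log_{√2} y⌋ modulo k + 1, where c = ⌈b/a⌉ ≤ (√2)^k.  For a triple
-- {x, y, z} with y = ax + d and z = bx + 2d one has √2·y ≤ z ≤ c·y: the upper bound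
-- because b ≤ ca and 2 ≤ c, the lower bound because the hypothesis forces b ≥ √2·a.
-- So ⌊log_{√2} z⌋ exceeds ⌊log_{√2} y⌋ by between 1 and k, and y, z get different
-- colours; a fortiori no colouring with more than k + 1 colours forces a triple.
module Submission where

open import Defs
open import Data.Nat using (ℕ; _+_; _*_; _∸_; _≤_; _<_)
open import Data.Product using (_×_)
open import Relation.Nullary using (¬_)
open import Data.Nat using (zero; suc; z≤n; s≤s; s≤s⁻¹; _^_; _%_; ⌊_/2⌋; ⌈_/2⌉; NonZero; >-nonZero; _≤?_; _<?_)
open import Data.Nat.Properties
open import Data.Nat.DivMod using (_mod_; m≡m%n+[m/n]*n; m%n<n; m<n⇒m%n≡m; m≤n⇒[n∸m]%m≡n%m; %-distribˡ-+)
open import Data.Nat.Induction using (<-wellFounded)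
open import Data.Nat.Logarithm using (⌊log₂_⌋; ⌈log₂_⌉; ⌊log₂⌋-mono-≤; ⌊log₂[2*b]⌋≡1+⌊log₂b⌋)
open import Data.Nat.Logarithm.Core using (⌈log2⌉)
open import Data.Nat.Tactic.RingSolver using (solve-∀)
open import Data.Product using (_,_)
open import Data.Fin using (Fin; toℕ; inject≤)
open import Data.Fin.Properties using (toℕ-fromℕ<; inject≤-injective)
open import Data.Sum using (inj₁; inj₂)
open import Data.Empty using (⊥-elim)
open import Relation.Nullary using (yes; no)
open import Function using (_∘_)
open import Function.Definitions using (Injective)
open import Induction.WellFounded using (Acc; acc)
open import Relation.Binary.PropositionalEquality

n≤2*⌈n/2⌉ : ∀ n → n ≤ 2 * ⌈ n /2⌉
n≤2*⌈n/2⌉ n = begin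
  n                       ≡⟨ ⌊n/2⌋+⌈n/2⌉≡n n ⟨
  ⌊ n /2⌋ + ⌈ n /2⌉       ≤⟨ +-monoˡ-≤ ⌈ n /2⌉ (⌊n/2⌋≤⌈n/2⌉ n) ⟩
  ⌈ n /2⌉ + ⌈ n /2⌉       ≡⟨ cong (⌈ n /2⌉ +_) (+-identityʳ ⌈ n /2⌉) ⟨
  2 * ⌈ n /2⌉             ∎
  where open ≤-Reasoning

n≤2^⌈log2⌉n : ∀ n (rec : Acc _<_ n) → n ≤ 2 ^ ⌈log2⌉ n rec
n≤2^⌈log2⌉n 0 _ = z≤n
n≤2^⌈log2⌉n 1 _ = s≤s z≤n
n≤2^⌈log2⌉n (suc (suc n)) (acc rs) =
  ≤-trans (n≤2*⌈n/2⌉ (suc (suc n)))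
          (*-monoʳ-≤ 2 (n≤2^⌈log2⌉n (suc ⌈ n /2⌉) (rs (⌈n/2⌉<n n))))

n≤2^⌈log₂n⌉ : ∀ n → n ≤ 2 ^ ⌈log₂ n ⌉
n≤2^⌈log₂n⌉ n = n≤2^⌈log2⌉n n (<-wellFounded n)

⌊log₂[2^k*n]⌋≡k+⌊log₂n⌋ : ∀ k n .{{_ : NonZero n}} → ⌊log₂ (2 ^ k * n) ⌋ ≡ k + ⌊log₂ n ⌋
⌊log₂[2^k*n]⌋≡k+⌊log₂n⌋ zero    n = cong ⌊log₂_⌋ (+-identityʳ n)
⌊log₂[2^k*n]⌋≡k+⌊log₂n⌋ (suc k) n = begin
  ⌊log₂ (2 * 2 ^ k * n) ⌋    ≡⟨ cong ⌊log₂_⌋ (*-assoc 2 (2 ^ k) n) ⟩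
  ⌊log₂ (2 * (2 ^ k * n)) ⌋  ≡⟨ ⌊log₂[2*b]⌋≡1+⌊log₂b⌋ (2 ^ k * n) {{m*n≢0 (2 ^ k) n {{m^n≢0 2 k}}}} ⟩
  suc ⌊log₂ (2 ^ k * n) ⌋    ≡⟨ cong suc (⌊log₂[2^k*n]⌋≡k+⌊log₂n⌋ k n) ⟩
  suc (k + ⌊log₂ n ⌋)        ∎
  where open ≡-Reasoning

2*m≤n⇒⌊log₂m⌋<⌊log₂n⌋ : ∀ {m n} .{{_ : NonZero m}} → 2 * m ≤ n → ⌊log₂ m ⌋ < ⌊log₂ n ⌋
2*m≤n⇒⌊log₂m⌋<⌊log₂n⌋ {m} 2m≤n =
  ≤-trans (≤-reflexive (sym (⌊log₂[2*b]⌋≡1+⌊log₂b⌋ m))) (⌊log₂⌋-mono-≤ 2m≤n)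

n≤2^k*m⇒⌊log₂n⌋≤⌊log₂m⌋+k : ∀ k {m n} .{{_ : NonZero m}} → n ≤ 2 ^ k * m → ⌊log₂ n ⌋ ≤ ⌊log₂ m ⌋ + k
n≤2^k*m⇒⌊log₂n⌋≤⌊log₂m⌋+k k {m} {n} n≤2^km = begin
  ⌊log₂ n ⌋            ≤⟨ ⌊log₂⌋-mono-≤ n≤2^km ⟩
  ⌊log₂ (2 ^ k * m) ⌋  ≡⟨ ⌊log₂[2^k*n]⌋≡k+⌊log₂n⌋ k m ⟩
  k + ⌊log₂ m ⌋        ≡⟨ +-comm k ⌊log₂ m ⌋ ⟩
  ⌊log₂ m ⌋ + k        ∎
  where open ≤-Reasoning

[r+j]%n≢r : ∀ {r j n} .{{_ : NonZero n}} → r < n → 0 < j → j < n → (r + j) % n ≢ r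
[r+j]%n≢r {r} {j} {n} r<n 0<j j<n with r + j <? n
... | yes r+j<n = λ eq → <⇒≢ (m<m+n r 0<j) (sym (trans (sym (m<n⇒m%n≡m r+j<n)) eq))
... | no  r+j≮n = λ eq → <-irrefl eq (begin-strict
  (r + j) % n      ≡⟨ m≤n⇒[n∸m]%m≡n%m n≤r+j ⟨
  (r + j ∸ n) % n  ≡⟨ m<n⇒m%n≡m (<-trans r+j∸n<r r<n) ⟩
  r + j ∸ n        <⟨ r+j∸n<r ⟩
  r                ∎)
  where
  open ≤-Reasoning
  n≤r+j : n ≤ r + j
  n≤r+j = ≮⇒≥ r+j≮n
  r+j∸n<r : r + j ∸ n < r
  r+j∸n<r = subst (r + j ∸ n <_) (m+n∸n≡m r n) (∸-monoˡ-< (+-monoʳ-< r j<n) n≤r+j)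

m<n≤m+k⇒m%[1+k]≢n%[1+k] : ∀ {k m n} → m < n → n ≤ m + k → m % suc k ≢ n % suc k
m<n≤m+k⇒m%[1+k]≢n%[1+k] {k} {m} {n} m<n n≤m+k eq =
  [r+j]%n≢r (m%n<n m (suc k)) (m<n⇒0<n∸m m<n) j<1+k (begin
    (m % suc k + j) % suc k         ≡⟨ cong (λ i → (m % suc k + i) % suc k) (m<n⇒m%n≡m j<1+k) ⟨
    (m % suc k + j % suc k) % suc k ≡⟨ %-distribˡ-+ m j (suc k) ⟨
    (m + j) % suc k                 ≡⟨ cong (_% suc k) (m+[n∸m]≡n (<⇒≤ m<n)) ⟩
    n % suc k                       ≡⟨ eq ⟨
    m % suc k                       ∎)
  where
  open ≡-Reasoning
  j = n ∸ m
  j<1+k : j < suc k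
  j<1+k = s≤s (m≤n+o⇒m∸n≤o n m n≤m+k)

-- ⌊log₂ (y²)⌋ = ⌊log_{√2} y⌋
level : ℕ → ℕ
level y = ⌊log₂ (y * y) ⌋

colouring : (k : ℕ) → ℕ → Fin (suc k)
colouring k y = level y mod suc k

colouring-separates : ∀ k {y z} .{{_ : NonZero y}} →
  2 * (y * y) ≤ z * z → z * z ≤ 2 ^ k * (y * y) → colouring k y ≢ colouring k z
colouring-separates k {y} {z} lower upper eq =
  m<n≤m+k⇒m%[1+k]≢n%[1+k] (2*m≤n⇒⌊log₂m⌋<⌊log₂n⌋ {y * y} lower)
                          (n≤2^k*m⇒⌊log₂n⌋≤⌊log₂m⌋+k k {y * y} upper) (begin
    level y % suc k      ≡⟨ toℕ-fromℕ< _ ⟨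
    toℕ (colouring k y)  ≡⟨ cong toℕ eq ⟩
    toℕ (colouring k z)  ≡⟨ toℕ-fromℕ< _ ⟩
    level z % suc k      ∎)
  where
  open ≡-Reasoning
  instance
    y²≢0 : NonZero (y * y)
    y²≢0 = m*n≢0 y y

b≤ceilDiv[b,a]*a : ∀ a b .{{_ : NonZero a}} → b ≤ ceilDiv b a * a
b≤ceilDiv[b,a]*a (suc a) b = +-cancelˡ-≤ a b (c * suc a) (begin
  a + b                        ≡⟨ +-comm a b ⟩
  b + a                        ≡⟨ m≡m%n+[m/n]*n (b + a) (suc a) ⟩
  (b + a) % suc a + c * suc a  ≤⟨ +-monoˡ-≤ (c * suc a) (s≤s⁻¹ (m%n<n (b + a) (suc a))) ⟩
  a + c * suc a                ∎)
  where
  open ≤-Reasoning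
  c = ceilDiv b (suc a)

a<b≤c*a⇒2≤c : ∀ {a b c} → a < b → b ≤ c * a → 2 ≤ c
a<b≤c*a⇒2≤c {a} {b} {c} a<b b≤ca =
  *-cancelʳ-< a 1 c (subst (_< c * a) (sym (*-identityˡ a)) (<-≤-trans a<b b≤ca))

8[a∸1]²≤[a+b∸2]²⇒2a²≤b² : ∀ {a b} → 1 ≤ a → a < b →
  8 * ((a ∸ 1) * (a ∸ 1)) ≤ (a + b ∸ 2) * (a + b ∸ 2) → 2 * (a * a) ≤ b * b
8[a∸1]²≤[a+b∸2]²⇒2a²≤b² {1} {1} _ (s≤s ()) _
8[a∸1]²≤[a+b∸2]²⇒2a²≤b² {1} {suc (suc _)} _ _ _ = s≤s (s≤s z≤n)
8[a∸1]²≤[a+b∸2]²⇒2a²≤b² {suc (suc p)} _ a<b hyp with m≤n⇒∃[o]m+o≡n a<b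
... | q , refl = *-cancelˡ-≤ 2 (begin
  2 * (2 * (a * a))      ≤⟨ m≤m+n _ r ⟩
  2 * (2 * (a * a)) + r  ≤⟨ +-cancelˡ-≤ s _ _ (begin
    s + (2 * (2 * (a * a)) + r)         ≡⟨ identity p q ⟨
    8 * (suc p * suc p) + 2 * (b * b)  ≤⟨ +-monoˡ-≤ (2 * (b * b)) hyp ⟩
    s + 2 * (b * b)                     ∎) ⟩
  2 * (b * b)            ∎)
  where
  open ≤-Reasoning
  a = 2 + p
  b = 3 + p + q
  s = (p + b) * (p + b)
  r = 2 * (p * p) + (1 + q) * (1 + q) + 4 * q
  -- 8(a−1)² + 2b² − (a+b−2)² − 4a² = 2p² + (1+q)² + 4q ≥ 0 when a = 2 + p, b = a + 1 + q
  identity : ∀ p q → 8 * ((1 + p) * (1 + p)) + 2 * ((3 + p + q) * (3 + p + q))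
    ≡ (p + (3 + p + q)) * (p + (3 + p + q))
      + (2 * (2 * ((2 + p) * (2 + p))) + (2 * (p * p) + (1 + q) * (1 + q) + 4 * q))
  identity = solve-∀

2[ax+d]²≤[bx+2d]² : ∀ {a b} x d .{{_ : NonZero a}} → 2 * (a * a) ≤ b * b →
  2 * ((a * x + d) * (a * x + d)) ≤ (b * x + 2 * d) * (b * x + 2 * d)
2[ax+d]²≤[bx+2d]² {a} {b} x d 2a²≤b² with ≤-total b (2 * a)
... | inj₁ b≤2a = *-cancelˡ-≤ (a * a) {{m*n≢0 a a}} (begin
  a * a * (2 * (y * y))  ≡⟨ a²[2y²]≡[2a²]y² a y ⟩
  2 * (a * a) * (y * y)  ≤⟨ *-monoˡ-≤ (y * y) 2a²≤b² ⟩
  b * b * (y * y)        ≡⟨ b²y²≡[by]² b y ⟩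
  (b * y) * (b * y)      ≤⟨ *-mono-≤ by≤az by≤az ⟩
  (a * z) * (a * z)      ≡⟨ b²y²≡[by]² a z ⟨
  a * a * (z * z)        ∎)
  where
  open ≤-Reasoning
  y = a * x + d
  z = b * x + 2 * d
  a²[2y²]≡[2a²]y² : ∀ a y → a * a * (2 * (y * y)) ≡ 2 * (a * a) * (y * y)
  a²[2y²]≡[2a²]y² = solve-∀
  b²y²≡[by]² : ∀ b y → b * b * (y * y) ≡ (b * y) * (b * y)
  b²y²≡[by]² = solve-∀
  by≤az : b * y ≤ a * z
  by≤az = begin
    b * (a * x + d)          ≡⟨ distrib a b x d ⟩
    a * b * x + b * d        ≤⟨ +-monoʳ-≤ (a * b * x) (*-monoˡ-≤ d b≤2a) ⟩
    a * b * x + 2 * a * d    ≡⟨ distrib′ a b x d ⟨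
    a * (b * x + 2 * d)      ∎
    where
    distrib : ∀ a b x d → b * (a * x + d) ≡ a * b * x + b * d
    distrib = solve-∀
    distrib′ : ∀ a b x d → a * (b * x + 2 * d) ≡ a * b * x + 2 * a * d
    distrib′ = solve-∀
... | inj₂ 2a≤b = begin
  2 * (y * y)            ≤⟨ m≤n*m (2 * (y * y)) 2 ⟩
  2 * (2 * (y * y))      ≡⟨ 2[2y²]≡[2y]² y ⟩
  (2 * y) * (2 * y)      ≤⟨ *-mono-≤ 2y≤z 2y≤z ⟩
  z * z                  ∎
  where
  open ≤-Reasoning
  y = a * x + d
  z = b * x + 2 * d
  2[2y²]≡[2y]² : ∀ y → 2 * (2 * (y * y)) ≡ (2 * y) * (2 * y)
  2[2y²]≡[2y]² = solve-∀
  distrib : ∀ a x d → 2 * (a * x + d) ≡ 2 * a * x + 2 * d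
  distrib = solve-∀
  2y≤z : 2 * y ≤ z
  2y≤z = ≤-trans (≤-reflexive (distrib a x d)) (+-monoˡ-≤ (2 * d) (*-monoˡ-≤ x 2a≤b))

bx+2d≤c[ax+d] : ∀ {a b c} x d → b ≤ c * a → 2 ≤ c → b * x + 2 * d ≤ c * (a * x + d)
bx+2d≤c[ax+d] {a} {b} {c} x d b≤ca 2≤c = begin
  b * x + 2 * d        ≤⟨ +-mono-≤ (*-monoˡ-≤ x b≤ca) (*-monoˡ-≤ d 2≤c) ⟩
  c * a * x + c * d    ≡⟨ distrib c a x d ⟩
  c * (a * x + d)      ∎
  where
  open ≤-Reasoning
  distrib : ∀ c a x d → c * a * x + c * d ≡ c * (a * x + d)
  distrib = solve-∀

noMonoTriple : ∀ {a b c k} n .{{_ : NonZero a}} → 2 * (a * a) ≤ b * b → b ≤ c * a → 2 ≤ c →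
  c * c ≤ 2 ^ k → ¬ HasMonoTriple a b (suc k) n (colouring k)
noMonoTriple {a} {b} {c} {k} n 2a²≤b² b≤ca 2≤c c²≤2^k
  (x , d , _ , 1≤d , _ , _ , _ , χx≡χy , χx≡χz) =
  colouring-separates k {y} {z} {{>-nonZero (≤-trans 1≤d (m≤n+m d (a * x)))}}
    (2[ax+d]²≤[bx+2d]² {a} {b} x d 2a²≤b²) upper (trans (sym χx≡χy) χx≡χz)
  where
  open ≤-Reasoning
  y = a * x + d
  z = b * x + 2 * d
  z≤cy : z ≤ c * y
  z≤cy = bx+2d≤c[ax+d] x d b≤ca 2≤c
  upper : z * z ≤ 2 ^ k * (y * y)
  upper = begin
    z * z              ≤⟨ *-mono-≤ z≤cy z≤cy ⟩
    (c * y) * (c * y)  ≡⟨ square-* c y ⟩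
    (c * c) * (y * y)  ≤⟨ *-monoˡ-≤ (y * y) c²≤2^k ⟩
    2 ^ k * (y * y)    ∎
    where
    square-* : ∀ c y → (c * y) * (c * y) ≡ (c * c) * (y * y)
    square-* = solve-∀

HasMonoTriple-∘-injective : ∀ {a b r s n} {χ : ℕ → Fin r} (f : Fin r → Fin s) →
  Injective _≡_ _≡_ f → HasMonoTriple a b s n (f ∘ χ) → HasMonoTriple a b r n χ
HasMonoTriple-∘-injective f f-injective
  (x , d , 1≤x , 1≤d , x≤n , ax+d≤n , bx+2d≤n , χx≡χy , χx≡χz) =
  x , d , 1≤x , 1≤d , x≤n , ax+d≤n , bx+2d≤n , f-injective χx≡χy , f-injective χx≡χz

theorem3p1 : (a b : ℕ) → 1 ≤ a → a < b →
    8 * ((a ∸ 1) * (a ∸ 1)) ≤ (a + b ∸ 2) * (a + b ∸ 2) →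
    ¬ Regular a b × ((r : ℕ) → NExists a b r → r ≤ ceilLogSqrt2 (ceilDiv b a))
theorem3p1 a b 1≤a a<b hyp = notRegular , dor≤k
  where
  instance
    a≢0 : NonZero a
    a≢0 = >-nonZero 1≤a
  c = ceilDiv b a
  k = ceilLogSqrt2 c
  b≤ca : b ≤ c * a
  b≤ca = b≤ceilDiv[b,a]*a a b
  noTriple : ∀ n → ¬ HasMonoTriple a b (suc k) n (colouring k)
  noTriple n = noMonoTriple {a} {b} {c} {k} n (8[a∸1]²≤[a+b∸2]²⇒2a²≤b² 1≤a a<b hyp) b≤ca
                                             (a<b≤c*a⇒2≤c a<b b≤ca) (n≤2^⌈log₂n⌉ (c * c))
  notRegular : ¬ Regular a b
  notRegular regular with regular (suc k)
  ... | n , _ , forces = noTriple n (forces (colouring k))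
  dor≤k : (r : ℕ) → NExists a b r → r ≤ k
  dor≤k r (n , _ , forces) with r ≤? k
  ... | yes r≤k = r≤k
  ... | no  r≰k = ⊥-elim (noTriple n
        (HasMonoTriple-∘-injective {a} {b} (λ i → inject≤ i k<r) (inject≤-injective k<r k<r _ _)
                                   (forces (λ m → inject≤ (colouring k m) k<r))))
    where
    k<r : suc k ≤ r
    k<r = ≰⇒> r≰k
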